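{- Let $m \geq 2$ be an integer. Then the formal power series in $q$ $$ \sum_{j \geq 0} \sum_{k \geq 1} \frac{q^{3j+k}(1-q^k)}{(q^m;q^m)_j \,(q^m;q^m)_{j+k}} $$ has nonnegative coefficients.
   Context: For a monomial $a$ in $q$, an integer $r \geq 1$ and an integer $k \geq 0$, the $q$-Pochhammer symbol is $(a;q^r)_k = \prod_{i=0}^{k-1}(1-aq^{ri})$, with $(a;q^r)_0 = 1$. Thus $(q^m;q^m)_j = \prod_{i=1}^{j}(1-q^{mi})$, and the reciprocals are expanded as power series in $q$. -}

module Defs where

open import Data.Nat as ℕ using (ℕ; zero; suc; _∸_; _≤?_)
open import Data.Nat.Divisibility using (_∣?_)
open import Data.Integer as ℤ using (ℤ; 0ℤ; 1ℤ)
open import Data.Bool using (if_then_else_)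
open import Relation.Nullary using (does)

-- Formal power series in q with integer coefficients: n ↦ coefficient of q^n.
Series : Set
Series = ℕ → ℤ

sumUpTo : ℕ → (ℕ → ℤ) → ℤ
sumUpTo zero    f = f 0
sumUpTo (suc n) f = sumUpTo n f ℤ.+ f (suc n)

sumFrom1To : ℕ → (ℕ → ℤ) → ℤ
sumFrom1To zero    f = 0ℤ
sumFrom1To (suc n) f = sumFrom1To n f ℤ.+ f (suc n)

_⊛_ : Series → Series → Series
(f ⊛ g) n = sumUpTo n (λ i → f i ℤ.* g (n ∸ i))

_⊖_ : Series → Series → Series
(f ⊖ g) n = f n ℤ.- g n

mono : ℕ → Series
mono d n = if does (d ℕ.≟ n) then 1ℤ else 0ℤ

one : Series
one = mono 0

shift : ℕ → Series → Series
shift s f n = if does (s ≤? n) then f (n ∸ s) else 0ℤ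

-- power-series expansion of 1/(1 - q^d) (d ≥ 1): Σ_t q^{d t}
geom : ℕ → Series
geom d n = if does (d ∣? n) then 1ℤ else 0ℤ

-- 1/(q^m;q^m)_j = Π_{i=1}^{j} 1/(1 - q^{m i}), expanded as a power series
invPoch : ℕ → ℕ → Series
invPoch m zero    = one
invPoch m (suc j) = invPoch m j ⊛ geom (m ℕ.* suc j)

term : ℕ → ℕ → ℕ → Series
term m j k = shift (3 ℕ.* j ℕ.+ k) ((one ⊖ mono k) ⊛ (invPoch m j ⊛ invPoch m (j ℕ.+ k)))

-- coefficient of q^N in Σ_{j≥0} Σ_{k≥1} term m j k.
-- Only j ≤ N and 1 ≤ k ≤ N can contribute (the summand is divisible by q^{3j+k}),
-- so this finite sum is the exact coefficient.
series : ℕ → Series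
series m N = sumUpTo N (λ j → sumFrom1To N (λ k → term m j k N))

-- Fix j and put Pₖ = 1/((q^m;q^m)_j (q^m;q^m)_{j+k}), so that the (j,k) summand is
-- q^{3j+k} Pₖ − q^{3j+2k} Pₖ.  Each factor 1/(1 − q^d) has nonnegative coefficients and
-- constant term 1, hence Pₖ ≤ P_{2k} coefficientwise.  The negative part of the k-th
-- summand is therefore dominated by the positive part of the 2k-th one, and already the
-- inner sum over k has nonnegative coefficients.
module Submission where

open import Defs
open import Data.Nat using (ℕ)
open import Data.Integer using (0ℤ; _≤_)
open import Data.Nat using () renaming (_≤_ to _≤ℕ_)

open import Data.Nat as ℕ using (zero; suc; _∸_; _≤?_; _≤′_; ≤′-refl; ≤′-step; s≤s)
import Data.Nat.Properties as ℕP
open import Data.Nat.Divisibility using (_∣?_; _∣0)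
open import Data.Integer as ℤ using (ℤ; 1ℤ; +≤+; _-_; _*_)
import Data.Integer.Properties as ℤP
open import Data.Integer.Tactic.RingSolver using (solve-∀)
open import Data.Bool using (true; false; if_then_else_)
open import Relation.Nullary using (does; yes; no)
open import Relation.Nullary.Decidable using (dec-true; dec-false)
open import Relation.Binary using (Tri; tri<; tri≈; tri>)
open import Relation.Binary.PropositionalEquality

NonNeg : Series → Set
NonNeg f = ∀ n → 0ℤ ≤ f n

infix 4 _≤ₛ_
_≤ₛ_ : Series → Series → Set
f ≤ₛ g = ∀ n → f n ≤ g n

*-monoˡ-≤-0≤ : ∀ {i j k} → 0ℤ ≤ i → j ≤ k → i * j ≤ i * k
*-monoˡ-≤-0≤ {i} 0≤i = ℤP.*-monoˡ-≤-nonNeg i {{ℤ.nonNegative 0≤i}}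

0≤i*j : ∀ {i j} → 0ℤ ≤ i → 0ℤ ≤ j → 0ℤ ≤ i * j
0≤i*j {i} {j} 0≤i 0≤j = subst (_≤ i * j) (ℤP.*-zeroʳ i) (*-monoˡ-≤-0≤ 0≤i 0≤j)

[a-b]+[c-d]≡[a+c]-[b+d] : ∀ a b c d → (a - b) ℤ.+ (c - d) ≡ (a ℤ.+ c) - (b ℤ.+ d)
[a-b]+[c-d]≡[a+c]-[b+d] = solve-∀

[a-b]*c≡a*c-b*c : ∀ a b c → (a - b) * c ≡ a * c - b * c
[a-b]*c≡a*c-b*c = solve-∀

sumUpTo-cong : ∀ n {f g : ℕ → ℤ} → (∀ i → f i ≡ g i) → sumUpTo n f ≡ sumUpTo n g
sumUpTo-cong zero    f≡g = f≡g 0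
sumUpTo-cong (suc n) f≡g = cong₂ ℤ._+_ (sumUpTo-cong n f≡g) (f≡g (suc n))

sumUpTo-nonNeg : ∀ n {f : ℕ → ℤ} → (∀ i → 0ℤ ≤ f i) → 0ℤ ≤ sumUpTo n f
sumUpTo-nonNeg zero    0≤f = 0≤f 0
sumUpTo-nonNeg (suc n) 0≤f = ℤP.+-mono-≤ (sumUpTo-nonNeg n 0≤f) (0≤f (suc n))

sumUpTo-mono : ∀ n {f g : ℕ → ℤ} → (∀ i → f i ≤ g i) → sumUpTo n f ≤ sumUpTo n g
sumUpTo-mono zero    f≤g = f≤g 0
sumUpTo-mono (suc n) f≤g = ℤP.+-mono-≤ (sumUpTo-mono n f≤g) (f≤g (suc n))

last≤sumUpTo : ∀ n {f : ℕ → ℤ} → (∀ i → 0ℤ ≤ f i) → f n ≤ sumUpTo n f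
last≤sumUpTo zero    0≤f = ℤP.≤-refl
last≤sumUpTo (suc n) {f} 0≤f =
  ℤP.i≤j+i (f (suc n)) (sumUpTo n f) {{ℤ.nonNegative (sumUpTo-nonNeg n 0≤f)}}

sumUpTo-distrib-sub : ∀ n (f g : ℕ → ℤ) → sumUpTo n (λ i → f i - g i) ≡ sumUpTo n f - sumUpTo n g
sumUpTo-distrib-sub zero    f g = refl
sumUpTo-distrib-sub (suc n) f g =
  trans (cong (ℤ._+ (f (suc n) - g (suc n))) (sumUpTo-distrib-sub n f g))
        ([a-b]+[c-d]≡[a+c]-[b+d] (sumUpTo n f) (sumUpTo n g) (f (suc n)) (g (suc n)))

sumFrom1To-mono : ∀ n {f g : ℕ → ℤ} → (∀ i → f i ≤ g i) → sumFrom1To n f ≤ sumFrom1To n g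
sumFrom1To-mono zero    f≤g = ℤP.≤-refl
sumFrom1To-mono (suc n) f≤g = ℤP.+-mono-≤ (sumFrom1To-mono n f≤g) (f≤g (suc n))

sumFrom1To-cong : ∀ n {f g : ℕ → ℤ} → (∀ i → f i ≡ g i) → sumFrom1To n f ≡ sumFrom1To n g
sumFrom1To-cong zero    f≡g = refl
sumFrom1To-cong (suc n) f≡g = cong₂ ℤ._+_ (sumFrom1To-cong n f≡g) (f≡g (suc n))

sumFrom1To-distrib-sub : ∀ n (f g : ℕ → ℤ) →
                       sumFrom1To n (λ i → f i - g i) ≡ sumFrom1To n f - sumFrom1To n g
sumFrom1To-distrib-sub zero    f g = refl
sumFrom1To-distrib-sub (suc n) f g =
  trans (cong (ℤ._+ (f (suc n) - g (suc n))) (sumFrom1To-distrib-sub n f g))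
        ([a-b]+[c-d]≡[a+c]-[b+d] (sumFrom1To n f) (sumFrom1To n g) (f (suc n)) (g (suc n)))

sumFrom1To-evens≤ : ∀ {f : ℕ → ℤ} → (∀ i → 0ℤ ≤ f i) →
                    ∀ n → sumFrom1To n (λ k → f (k ℕ.+ k)) ≤ sumFrom1To (n ℕ.+ n) f
sumFrom1To-evens≤ 0≤f zero = ℤP.≤-refl
sumFrom1To-evens≤ {f} 0≤f (suc n) rewrite ℕP.+-suc n n =
  ℤP.+-monoˡ-≤ (f (suc (suc (n ℕ.+ n))))
    (ℤP.≤-trans (sumFrom1To-evens≤ 0≤f n)
                (ℤP.i≤i+j (sumFrom1To (n ℕ.+ n) f) (f (suc (n ℕ.+ n))) {{ℤ.nonNegative (0≤f _)}}))

sumFrom1To-vanishing : ∀ {f : ℕ → ℤ} N → (∀ i → N ℕ.< i → f i ≡ 0ℤ) →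
                       ∀ d → sumFrom1To (N ℕ.+ d) f ≡ sumFrom1To N f
sumFrom1To-vanishing N f≡0 zero rewrite ℕP.+-identityʳ N = refl
sumFrom1To-vanishing N f≡0 (suc d)
  rewrite ℕP.+-suc N d | f≡0 (suc (N ℕ.+ d)) (s≤s (ℕP.m≤m+n N d)) =
  trans (ℤP.+-identityʳ _) (sumFrom1To-vanishing N f≡0 d)

shift-cong : ∀ s {f g : Series} → (∀ n → f n ≡ g n) → ∀ n → shift s f n ≡ shift s g n
shift-cong s f≡g n with does (s ≤? n)
... | true  = f≡g (n ∸ s)
... | false = refl

shift-⊖ : ∀ s (f g : Series) n → shift s (f ⊖ g) n ≡ shift s f n - shift s g n
shift-⊖ s f g n with does (s ≤? n)
... | true  = refl
... | false = refl

shift-nonNeg : ∀ s {f : Series} → NonNeg f → NonNeg (shift s f)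
shift-nonNeg s 0≤f n with does (s ≤? n)
... | true  = 0≤f (n ∸ s)
... | false = ℤP.≤-refl

shift-mono : ∀ s {f g : Series} → f ≤ₛ g → shift s f ≤ₛ shift s g
shift-mono s f≤g n with does (s ≤? n)
... | true  = f≤g (n ∸ s)
... | false = ℤP.≤-refl

shift-vanishes : ∀ s (f : Series) {n} → n ℕ.< s → shift s f n ≡ 0ℤ
shift-vanishes s f {n} n<s rewrite dec-false (s ≤? n) (ℕP.<⇒≱ n<s) = refl

shift-identity : ∀ (f : Series) n → shift 0 f n ≡ f n
shift-identity f n rewrite dec-true (0 ≤? n) ℕ.z≤n = refl

shift-shift : ∀ a b (f : Series) n → shift a (shift b f) n ≡ shift (a ℕ.+ b) f n
shift-shift a b f n with a ≤? n
... | no a≰n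
  rewrite dec-false (a ≤? n) a≰n
        | dec-false (a ℕ.+ b ≤? n) (λ a+b≤n → a≰n (ℕP.m+n≤o⇒m≤o a a+b≤n)) = refl
... | yes a≤n rewrite dec-true (a ≤? n) a≤n with b ≤? (n ∸ a)
...   | yes b≤n-a
  rewrite dec-true (b ≤? n ∸ a) b≤n-a
        | dec-true (a ℕ.+ b ≤? n)
            (subst (a ℕ.+ b ≤ℕ_) (ℕP.m+[n∸m]≡n a≤n) (ℕP.+-monoʳ-≤ a b≤n-a))
  = cong f (ℕP.∸-+-assoc n a b)
...   | no b≰n-a
  rewrite dec-false (b ≤? n ∸ a) b≰n-a
        | dec-false (a ℕ.+ b ≤? n)
            (λ a+b≤n → b≰n-a (ℕP.m+n≤o⇒m≤o∸n b (subst (_≤ℕ n) (ℕP.+-comm a b) a+b≤n)))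
  = refl

sumUpTo-monomial : ∀ k n (g : ℕ → ℤ) →
                   sumUpTo n (λ i → mono k i * g i) ≡ (if does (k ≤? n) then g k else 0ℤ)
sumUpTo-monomial zero    zero    g = ℤP.*-identityˡ (g 0)
sumUpTo-monomial (suc k) zero    g = refl
sumUpTo-monomial k       (suc n) g =
  trans (cong (ℤ._+ mono k (suc n) * g (suc n)) (sumUpTo-monomial k n g))
        (new-term (ℕP.<-cmp k (suc n)))
  where
  new-term : Tri (k ℕ.< suc n) (k ≡ suc n) (suc n ℕ.< k) →
             (if does (k ≤? n) then g k else 0ℤ) ℤ.+ mono k (suc n) * g (suc n)
               ≡ (if does (k ≤? suc n) then g k else 0ℤ)
  new-term (tri< k<1+n _ _)
    rewrite dec-true (k ≤? n) (ℕP.≤-pred k<1+n)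
          | dec-false (k ℕ.≟ suc n) (ℕP.<⇒≢ k<1+n)
          | dec-true (k ≤? suc n) (ℕP.<⇒≤ k<1+n) = ℤP.+-identityʳ (g k)
  new-term (tri≈ _ refl _)
    rewrite dec-false (suc n ≤? n) (ℕP.<⇒≱ (ℕP.n<1+n n))
          | dec-true (suc n ℕ.≟ suc n) refl
          | dec-true (suc n ≤? suc n) ℕP.≤-refl = trans (ℤP.+-identityˡ _) (ℤP.*-identityˡ _)
  new-term (tri> _ _ 1+n<k)
    rewrite dec-false (k ≤? n) (ℕP.<⇒≱ (ℕP.<-trans (ℕP.n<1+n n) 1+n<k))
          | dec-false (k ℕ.≟ suc n) (ℕP.>⇒≢ 1+n<k)
          | dec-false (k ≤? suc n) (ℕP.<⇒≱ 1+n<k) = refl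

mono-⊛ : ∀ k (f : Series) n → (mono k ⊛ f) n ≡ shift k f n
mono-⊛ k f n = sumUpTo-monomial k n (λ i → f (n ∸ i))

⊖-⊛ : ∀ (f g h : Series) n → ((f ⊖ g) ⊛ h) n ≡ (f ⊛ h) n - (g ⊛ h) n
⊖-⊛ f g h n =
  trans (sumUpTo-cong n (λ i → [a-b]*c≡a*c-b*c (f i) (g i) (h (n ∸ i))))
        (sumUpTo-distrib-sub n (λ i → f i * h (n ∸ i)) (λ i → g i * h (n ∸ i)))

[one⊖mono]-⊛ : ∀ k (f : Series) n → ((one ⊖ mono k) ⊛ f) n ≡ f n - shift k f n
[one⊖mono]-⊛ k f n =
  trans (⊖-⊛ one (mono k) f n)
        (cong₂ _-_ (trans (mono-⊛ 0 f n) (shift-identity f n)) (mono-⊛ k f n))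

⊛-nonNeg : ∀ {f g : Series} → NonNeg f → NonNeg g → NonNeg (f ⊛ g)
⊛-nonNeg 0≤f 0≤g n = sumUpTo-nonNeg n (λ i → 0≤i*j (0≤f i) (0≤g (n ∸ i)))

⊛-monoʳ : ∀ {f g h : Series} → NonNeg f → g ≤ₛ h → f ⊛ g ≤ₛ f ⊛ h
⊛-monoʳ 0≤f g≤h n = sumUpTo-mono n (λ i → *-monoˡ-≤-0≤ (0≤f i) (g≤h (n ∸ i)))

f≤ₛf⊛g : ∀ {f g : Series} → NonNeg f → NonNeg g → g 0 ≡ 1ℤ → f ≤ₛ f ⊛ g
f≤ₛf⊛g {f} {g} 0≤f 0≤g g0≡1 n =
  subst (_≤ (f ⊛ g) n) f[n]*g[0]≡f[n] (last≤sumUpTo n (λ i → 0≤i*j (0≤f i) (0≤g (n ∸ i))))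
  where
  f[n]*g[0]≡f[n] : f n * g (n ∸ n) ≡ f n
  f[n]*g[0]≡f[n] rewrite ℕP.n∸n≡0 n | g0≡1 = ℤP.*-identityʳ (f n)

one-nonNeg : NonNeg one
one-nonNeg n with does (0 ℕ.≟ n)
... | true  = +≤+ ℕ.z≤n
... | false = ℤP.≤-refl

geom-nonNeg : ∀ d → NonNeg (geom d)
geom-nonNeg d n with does (d ∣? n)
... | true  = +≤+ ℕ.z≤n
... | false = ℤP.≤-refl

geom-constant : ∀ d → geom d 0 ≡ 1ℤ
geom-constant d rewrite dec-true (d ∣? 0) (d ∣0) = refl

invPoch-nonNeg : ∀ m j → NonNeg (invPoch m j)
invPoch-nonNeg m zero    = one-nonNeg
invPoch-nonNeg m (suc j) = ⊛-nonNeg (invPoch-nonNeg m j) (geom-nonNeg (m ℕ.* suc j))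

invPoch-mono : ∀ m {i j} → i ≤′ j → invPoch m i ≤ₛ invPoch m j
invPoch-mono m ≤′-refl n = ℤP.≤-refl
invPoch-mono m (≤′-step {j} i≤′j) n =
  ℤP.≤-trans (invPoch-mono m i≤′j n)
    (f≤ₛf⊛g (invPoch-nonNeg m j) (geom-nonNeg (m ℕ.* suc j)) (geom-constant (m ℕ.* suc j)) n)

-- The partner 2k of k may exceed N, but positive parts with k > N do not reach q^N.
sumFrom1To-[one⊖mono]-nonNeg :
  (P : ℕ → Series) → (∀ k → NonNeg (P k)) → (∀ k → P k ≤ₛ P (k ℕ.+ k)) →
  ∀ a N → 0ℤ ≤ sumFrom1To N (λ k → shift (a ℕ.+ k) ((one ⊖ mono k) ⊛ P k) N)
sumFrom1To-[one⊖mono]-nonNeg P 0≤P P-mono a N =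
  subst (0ℤ ≤_) (sym sum-split) (ℤP.i≤j⇒0≤j-i negatives≤positives)
  where
  positive negative : ℕ → ℤ
  positive k = shift (a ℕ.+ k) (P k) N
  negative k = shift (a ℕ.+ k ℕ.+ k) (P k) N

  summand-split : ∀ k → shift (a ℕ.+ k) ((one ⊖ mono k) ⊛ P k) N ≡ positive k - negative k
  summand-split k = begin
    shift (a ℕ.+ k) ((one ⊖ mono k) ⊛ P k) N
      ≡⟨ shift-cong (a ℕ.+ k) ([one⊖mono]-⊛ k (P k)) N ⟩
    shift (a ℕ.+ k) (P k ⊖ shift k (P k)) N
      ≡⟨ shift-⊖ (a ℕ.+ k) (P k) (shift k (P k)) N ⟩
    positive k - shift (a ℕ.+ k) (shift k (P k)) N
      ≡⟨ cong (positive k -_) (shift-shift (a ℕ.+ k) k (P k) N) ⟩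
    positive k - negative k ∎
    where open ≡-Reasoning

  sum-split : sumFrom1To N (λ k → shift (a ℕ.+ k) ((one ⊖ mono k) ⊛ P k) N)
              ≡ sumFrom1To N positive - sumFrom1To N negative
  sum-split = trans (sumFrom1To-cong N summand-split) (sumFrom1To-distrib-sub N positive negative)

  negative≤positive-double : ∀ k → negative k ≤ positive (k ℕ.+ k)
  negative≤positive-double k rewrite ℕP.+-assoc a k k =
    shift-mono (a ℕ.+ (k ℕ.+ k)) (P-mono k) N

  positive-vanishing : ∀ k → N ℕ.< k → positive k ≡ 0ℤ
  positive-vanishing k N<k =
    shift-vanishes (a ℕ.+ k) (P k) (ℕP.<-≤-trans N<k (ℕP.m≤n+m k a))

  negatives≤positives : sumFrom1To N negative ≤ sumFrom1To N positive
  negatives≤positives = begin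
    sumFrom1To N negative                       ≤⟨ sumFrom1To-mono N negative≤positive-double ⟩
    sumFrom1To N (λ k → positive (k ℕ.+ k))     ≤⟨ sumFrom1To-evens≤ (λ k → shift-nonNeg (a ℕ.+ k) (0≤P k) N) N ⟩
    sumFrom1To (N ℕ.+ N) positive               ≡⟨ sumFrom1To-vanishing N positive-vanishing N ⟩
    sumFrom1To N positive                       ∎
    where open ℤP.≤-Reasoning

mainTheorem2 : (m : ℕ) → 2 ≤ℕ m → (N : ℕ) → 0ℤ ≤ series m N
mainTheorem2 m _ N =
  sumUpTo-nonNeg N (λ j → sumFrom1To-[one⊖mono]-nonNeg (P j) (P-nonNeg j) (P-mono j) (3 ℕ.* j) N)
  where
  P : ℕ → ℕ → Series
  P j k = invPoch m j ⊛ invPoch m (j ℕ.+ k)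

  P-nonNeg : ∀ j k → NonNeg (P j k)
  P-nonNeg j k = ⊛-nonNeg (invPoch-nonNeg m j) (invPoch-nonNeg m (j ℕ.+ k))

  P-mono : ∀ j k → P j k ≤ₛ P j (k ℕ.+ k)
  P-mono j k = ⊛-monoʳ (invPoch-nonNeg m j)
                 (invPoch-mono m (ℕP.≤⇒≤′ (ℕP.+-monoʳ-≤ j (ℕP.m≤m+n k k))))
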